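{- Let $k\ge 1$ and $i\ge 0$ be integers and let $\ell$ be an integer with $0\le \ell\le ik$. Let $G=(V,E)$ be a $(k,\ell)$-sparse hypergraph of dimension $s$ with $\ell\le sk-1$, and let $B_1$ and $B_2$ be blocks of $G$ whose vertex sets satisfy $|V(B_1)\cap V(B_2)|\ge i$. Then $B_1\cup B_2$ is a block of $G$, and the subgraph of $G$ induced by $V(B_1)\cap V(B_2)$ is a block of $G$.
   Context: A hypergraph $G=(V,E)$ consists of a finite vertex set $V$ and a finite multiset $E$ of nonempty subsets of $V$ (edges; parallel copies allowed, an edge of size one is a loop). The dimension of an edge $e$ is $|e|$, and the dimension of $G$ is the minimum dimension of its edges. For $V'\subseteq V$, $E(V')$ denotes the multiset of edges of $G$ contained in $V'$; the subgraph induced by $V'$ is $(V',E(V'))$. For integers $k\ge1$ and $\ell$, a hypergraph is $(k,\ell)$-sparse if $|E(V')|\le k|V'|-\ell$ for every $V'\subseteq V$ with $E(V')$ nonempty, and $(k,\ell)$-tight if it is $(k,\ell)$-sparse and has exactly $k|V|-\ell$ edges. A block of a $(k,\ell)$-sparse hypergraph $G$ is a subgraph $B=(V(B),E(B))$ of $G$ (i.e. $V(B)\subseteq V$, $E(B)\subseteq E$ as multisets, every edge of $E(B)$ contained in $V(B)$) that is $(k,\ell)$-tight. The union $B_1\cup B_2$ has vertex set $V(B_1)\cup V(B_2)$ and edge set $E(B_1)\cup E(B_2)$. -}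

module Defs where

open import Data.Nat as ℕ using (ℕ)
open import Data.Bool using (_∧_)
open import Data.Fin using (Fin)
open import Data.Fin.Subset using (Subset; _∈_; _⊆_; ∣_∣; Nonempty; ⊤)
open import Data.Fin.Subset.Properties using (_⊆?_)
open import Data.Vec using (tabulate; lookup)
open import Data.Integer as ℤ using (ℤ; +_)
open import Data.Product using (_×_; ∃)
open import Relation.Nullary using (does)
open import Relation.Binary.PropositionalEquality using (_≡_)

-- A hypergraph on vertex set Fin n with m edges, given as an indexed family
-- (so parallel copies are allowed: the edge multiset is {edge j | j : Fin m}).
record Hypergraph (n m : ℕ) : Set where
  field
    edge     : Fin m → Subset n
    nonempty : ∀ j → Nonempty (edge j)
open Hypergraph public

HasDimension : ∀ {n m} → Hypergraph n m → ℕ → Set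
HasDimension G s = (∀ j → s ℕ.≤ ∣ edge G j ∣) × ∃ (λ j → ∣ edge G j ∣ ≡ s)

EdgesIn : ∀ {n m} → Hypergraph n m → Subset m → Subset n → Subset m
EdgesIn G F V' = tabulate λ j → lookup F j ∧ does (edge G j ⊆? V')

Sparse : ∀ {n m} → Hypergraph n m → ℕ → ℕ → Subset n → Subset m → Set
Sparse {n} G k ℓ W F = ∀ (V' : Subset n) → V' ⊆ W → Nonempty (EdgesIn G F V') →
  (+ ∣ EdgesIn G F V' ∣) ℤ.≤ (+ (k ℕ.* ∣ V' ∣)) ℤ.- (+ ℓ)

IsSubgraph : ∀ {n m} → Hypergraph n m → Subset n → Subset m → Set
IsSubgraph G W F = ∀ j → j ∈ F → edge G j ⊆ W

Tight : ∀ {n m} → Hypergraph n m → ℕ → ℕ → Subset n → Subset m → Set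
Tight G k ℓ W F = Sparse G k ℓ W F × (+ ∣ F ∣ ≡ (+ (k ℕ.* ∣ W ∣)) ℤ.- (+ ℓ))

SparseHypergraph : ∀ {n m} → Hypergraph n m → ℕ → ℕ → Set
SparseHypergraph G k ℓ = Sparse G k ℓ ⊤ ⊤

IsBlock : ∀ {n m} → Hypergraph n m → ℕ → ℕ → Subset n → Subset m → Set
IsBlock G k ℓ W F = IsSubgraph G W F × Tight G k ℓ W F

{-# OPTIONS --safe #-}
-- By inclusion–exclusion, |E₁ ∪ E₂| + |E₁ ∩ E₂| = |E₁| + |E₂|
-- = (k|V₁ ∪ V₂| − ℓ) + (k|V₁ ∩ V₂| − ℓ). Since E₁ ∪ E₂ and E₁ ∩ E₂ lie in the
-- edge sets induced by V₁ ∪ V₂ and V₁ ∩ V₂, sparsity of G bounds the two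
-- summands by k|V₁ ∪ V₂| − ℓ and k|V₁ ∩ V₂| − ℓ; the second bound also holds
-- when V₁ ∩ V₂ spans no edge, because ℓ ≤ ik ≤ k|V₁ ∩ V₂|. So both bounds are
-- attained.
module Submission where

open import Defs
open import Data.Nat using (ℕ; _≤_; _<_; _*_)
open import Data.Product using (_×_)
open import Data.Fin.Subset using (Subset; _∪_; _∩_; ∣_∣; ⊤)

open import Data.Bool using (true; false; _∧_)
open import Data.Fin using (Fin)
open import Data.Fin.Subset using (_∈_; _⊆_; inside; outside)
open import Data.Fin.Subset.Properties
  using (_⊆?_; nonempty?; Empty-unique; ∣⊥∣≡0; ∈⊤; ⊆⊤; p⊆q⇒∣p∣≤∣q∣; ∣p∣≤∣p∪q∣;
         x∈p∪q⁻; x∈p∪q⁺; x∈p∩q⁻; x∈p∩q⁺)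
open import Data.Integer.Base as ℤ using (+_)
import Data.Integer.Properties as ℤ
open import Data.Nat using (suc; _+_)
import Data.Nat.Properties as ℕ
open import Data.Product using (_,_; map₂)
open import Data.Sum using (inj₁; inj₂)
open import Data.Vec using ([]; _∷_; lookup)
open import Data.Vec.Properties using ([]=⇒lookup; lookup⇒[]=; lookup∘tabulate)
open import Relation.Nullary using (yes; no; does)
open import Relation.Nullary.Decidable using (dec-true)
open import Relation.Binary.PropositionalEquality
  using (_≡_; refl; sym; trans; cong; cong₂; module ≡-Reasoning)
open import Algebra.Properties.AbelianGroup ℤ.+-0-abelianGroup
  using (//-rightDividesˡ; //-rightDividesʳ)
open import Algebra.Properties.CommutativeSemigroup ℕ.+-commutativeSemigroup
  using (interchange)

+a≡+b-+c⇒a+c≡b : ∀ {a b c} → + a ≡ + b ℤ.- + c → a + c ≡ b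
+a≡+b-+c⇒a+c≡b {a} {b} {c} a≡b-c = ℤ.+-injective (begin
  + (a + c)            ≡⟨ ℤ.pos-+ a c ⟩
  + a ℤ.+ + c          ≡⟨ cong (ℤ._+ + c) a≡b-c ⟩
  + b ℤ.- + c ℤ.+ + c  ≡⟨ //-rightDividesˡ (+ c) (+ b) ⟩
  + b                  ∎)
  where open ≡-Reasoning

a+c≡b⇒+a≡+b-+c : ∀ {a b c} → a + c ≡ b → + a ≡ + b ℤ.- + c
a+c≡b⇒+a≡+b-+c {a} {b} {c} a+c≡b = begin
  + a                  ≡⟨ //-rightDividesʳ (+ c) (+ a) ⟨
  + a ℤ.+ + c ℤ.- + c  ≡⟨ cong (ℤ._- + c) (ℤ.pos-+ a c) ⟨
  + (a + c) ℤ.- + c    ≡⟨ cong (λ x → + x ℤ.- + c) a+c≡b ⟩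
  + b ℤ.- + c          ∎
  where open ≡-Reasoning

+a≤+b-+c⇒a+c≤b : ∀ {a b c} → + a ℤ.≤ + b ℤ.- + c → a + c ≤ b
+a≤+b-+c⇒a+c≤b {a} {b} {c} a≤b-c = ℤ.drop‿+≤+ (begin
  + (a + c)            ≡⟨ ℤ.pos-+ a c ⟩
  + a ℤ.+ + c          ≤⟨ ℤ.+-monoˡ-≤ (+ c) a≤b-c ⟩
  + b ℤ.- + c ℤ.+ + c  ≡⟨ //-rightDividesˡ (+ c) (+ b) ⟩
  + b                  ∎)
  where open ℤ.≤-Reasoning

+-squeeze : ∀ {a b c d} → a ≤ c → b ≤ d → c + d ≤ a + b → a ≡ c × b ≡ d
+-squeeze {a} {b} {c} {d} a≤c b≤d c+d≤a+b =
  ℕ.≤-antisym a≤c (ℕ.+-cancelʳ-≤ d c a (ℕ.≤-trans c+d≤a+b (ℕ.+-monoʳ-≤ a b≤d))) ,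
  ℕ.≤-antisym b≤d (ℕ.+-cancelˡ-≤ c d b (ℕ.≤-trans c+d≤a+b (ℕ.+-monoˡ-≤ b a≤c)))

∣p∪q∣+∣p∩q∣≡∣p∣+∣q∣ : ∀ {n} (p q : Subset n) → ∣ p ∪ q ∣ + ∣ p ∩ q ∣ ≡ ∣ p ∣ + ∣ q ∣
∣p∪q∣+∣p∩q∣≡∣p∣+∣q∣ []            []            = refl
∣p∪q∣+∣p∩q∣≡∣p∣+∣q∣ (outside ∷ p) (outside ∷ q) = ∣p∪q∣+∣p∩q∣≡∣p∣+∣q∣ p q
∣p∪q∣+∣p∩q∣≡∣p∣+∣q∣ (inside  ∷ p) (outside ∷ q) = cong suc (∣p∪q∣+∣p∩q∣≡∣p∣+∣q∣ p q)
∣p∪q∣+∣p∩q∣≡∣p∣+∣q∣ (outside ∷ p) (inside  ∷ q) =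
  trans (cong suc (∣p∪q∣+∣p∩q∣≡∣p∣+∣q∣ p q)) (sym (ℕ.+-suc (∣ p ∣) (∣ q ∣)))
∣p∪q∣+∣p∩q∣≡∣p∣+∣q∣ (inside  ∷ p) (inside  ∷ q) = cong suc (begin
  ∣ p ∪ q ∣ + suc (∣ p ∩ q ∣)  ≡⟨ ℕ.+-suc (∣ p ∪ q ∣) (∣ p ∩ q ∣) ⟩
  suc (∣ p ∪ q ∣ + ∣ p ∩ q ∣)  ≡⟨ cong suc (∣p∪q∣+∣p∩q∣≡∣p∣+∣q∣ p q) ⟩
  suc (∣ p ∣ + ∣ q ∣)          ≡⟨ ℕ.+-suc (∣ p ∣) (∣ q ∣) ⟨
  ∣ p ∣ + suc (∣ q ∣)          ∎)
  where open ≡-Reasoning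

module _ {n m : ℕ} (G : Hypergraph n m) where

  private variable
    j : Fin m
    W V₁ V₂ : Subset n
    F F′ E₁ E₂ : Subset m

  lookup-EdgesIn : ∀ F W j → lookup (EdgesIn G F W) j ≡ lookup F j ∧ does (edge G j ⊆? W)
  lookup-EdgesIn F W = lookup∘tabulate _

  ∈EdgesIn⁻ : ∀ F W → j ∈ EdgesIn G F W → j ∈ F × edge G j ⊆ W
  ∈EdgesIn⁻ {j} F W j∈
    with lookup F j in j∈F | edge G j ⊆? W | trans (sym (lookup-EdgesIn F W j)) ([]=⇒lookup j∈)
  ... | true  | yes e⊆W | _  = lookup⇒[]= j F j∈F , e⊆W
  ... | true  | no _    | ()
  ... | false | _       | ()

  ∈EdgesIn⁺ : j ∈ F → edge G j ⊆ W → j ∈ EdgesIn G F W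
  ∈EdgesIn⁺ {j} {F} {W} j∈F e⊆W = lookup⇒[]= j (EdgesIn G F W) (begin
    lookup (EdgesIn G F W) j           ≡⟨ lookup-EdgesIn F W j ⟩
    lookup F j ∧ does (edge G j ⊆? W)  ≡⟨ cong₂ _∧_ ([]=⇒lookup j∈F) (dec-true (edge G j ⊆? W) e⊆W) ⟩
    true                               ∎)
    where open ≡-Reasoning

  EdgesIn-monoˡ : ∀ W → F ⊆ F′ → EdgesIn G F W ⊆ EdgesIn G F′ W
  EdgesIn-monoˡ {F} W F⊆F′ j∈ = let j∈F , e⊆W = ∈EdgesIn⁻ F W j∈ in ∈EdgesIn⁺ (F⊆F′ j∈F) e⊆W

  EdgesIn-isSubgraph : ∀ F W → IsSubgraph G W (EdgesIn G F W)
  EdgesIn-isSubgraph F W _ j∈ = let _ , e⊆W = ∈EdgesIn⁻ F W j∈ in e⊆W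

  IsSubgraph⇒⊆EdgesIn : IsSubgraph G W F → F ⊆ EdgesIn G ⊤ W
  IsSubgraph⇒⊆EdgesIn sub j∈F = ∈EdgesIn⁺ ∈⊤ (sub _ j∈F)

  IsSubgraph-∪ : IsSubgraph G V₁ E₁ → IsSubgraph G V₂ E₂ → IsSubgraph G (V₁ ∪ V₂) (E₁ ∪ E₂)
  IsSubgraph-∪ {E₁ = E₁} {E₂ = E₂} sub₁ sub₂ j j∈ x∈ with x∈p∪q⁻ E₁ E₂ j∈
  ... | inj₁ j∈E₁ = x∈p∪q⁺ (inj₁ (sub₁ j j∈E₁ x∈))
  ... | inj₂ j∈E₂ = x∈p∪q⁺ (inj₂ (sub₂ j j∈E₂ x∈))

  IsSubgraph-∩ : IsSubgraph G V₁ E₁ → IsSubgraph G V₂ E₂ → IsSubgraph G (V₁ ∩ V₂) (E₁ ∩ E₂)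
  IsSubgraph-∩ {E₁ = E₁} {E₂ = E₂} sub₁ sub₂ j j∈ x∈ =
    let j∈E₁ , j∈E₂ = x∈p∩q⁻ E₁ E₂ j∈ in x∈p∩q⁺ (sub₁ j j∈E₁ x∈ , sub₂ j j∈E₂ x∈)

module _ {n m : ℕ} (G : Hypergraph n m) (k ℓ : ℕ) (sparse : SparseHypergraph G k ℓ) where

  Sparse-inherited : ∀ W F → Sparse G k ℓ W F
  Sparse-inherited W F V′ _ ne =
    ℤ.≤-trans (ℤ.+≤+ (p⊆q⇒∣p∣≤∣q∣ F[V′]⊆E[V′])) (sparse V′ ⊆⊤ (map₂ F[V′]⊆E[V′] ne))
    where
    F[V′]⊆E[V′] : EdgesIn G F V′ ⊆ EdgesIn G ⊤ V′
    F[V′]⊆E[V′] = EdgesIn-monoˡ G {F = F} V′ ⊆⊤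

  ∣EdgesIn∣+ℓ≤k*∣W∣ : ∀ W → ℓ ≤ k * ∣ W ∣ → ∣ EdgesIn G ⊤ W ∣ + ℓ ≤ k * ∣ W ∣
  ∣EdgesIn∣+ℓ≤k*∣W∣ W ℓ≤k∣W∣ with nonempty? (EdgesIn G ⊤ W)
  ... | yes ne = +a≤+b-+c⇒a+c≤b (sparse W ⊆⊤ ne)
  ... | no ¬ne rewrite Empty-unique ¬ne | ∣⊥∣≡0 m = ℓ≤k∣W∣

  tight-subgraph⇒IsBlock : ∀ W F → IsSubgraph G W F →
                           ∣ F ∣ + ℓ ≡ k * ∣ W ∣ → IsBlock G k ℓ W F
  tight-subgraph⇒IsBlock W F sub count =
    sub , Sparse-inherited W F , a+c≡b⇒+a≡+b-+c count

  ∪-∩-tight : ∀ V₁ V₂ E₁ E₂ → ℓ ≤ k * ∣ V₁ ∩ V₂ ∣ →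
              IsBlock G k ℓ V₁ E₁ → IsBlock G k ℓ V₂ E₂ →
              ∣ E₁ ∪ E₂ ∣ + ℓ ≡ k * ∣ V₁ ∪ V₂ ∣ ×
              ∣ EdgesIn G ⊤ (V₁ ∩ V₂) ∣ + ℓ ≡ k * ∣ V₁ ∩ V₂ ∣
  ∪-∩-tight V₁ V₂ E₁ E₂ ℓ≤k∣V₁∩V₂∣ (sub₁ , _ , tight₁) (sub₂ , _ , tight₂) =
    +-squeeze ∪-bound ∩-bound counting
    where
    open ℕ.≤-Reasoning

    count₁ : ∣ E₁ ∣ + ℓ ≡ k * ∣ V₁ ∣
    count₁ = +a≡+b-+c⇒a+c≡b tight₁

    count₂ : ∣ E₂ ∣ + ℓ ≡ k * ∣ V₂ ∣
    count₂ = +a≡+b-+c⇒a+c≡b tight₂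

    ℓ≤k∣V₁∪V₂∣ : ℓ ≤ k * ∣ V₁ ∪ V₂ ∣
    ℓ≤k∣V₁∪V₂∣ = begin
      ℓ                ≤⟨ ℕ.m≤n+m ℓ (∣ E₁ ∣) ⟩
      ∣ E₁ ∣ + ℓ       ≡⟨ count₁ ⟩
      k * ∣ V₁ ∣       ≤⟨ ℕ.*-monoʳ-≤ k (∣p∣≤∣p∪q∣ V₁ V₂) ⟩
      k * ∣ V₁ ∪ V₂ ∣  ∎

    E₁∪E₂⊆E[V₁∪V₂] : E₁ ∪ E₂ ⊆ EdgesIn G ⊤ (V₁ ∪ V₂)
    E₁∪E₂⊆E[V₁∪V₂] = IsSubgraph⇒⊆EdgesIn G (IsSubgraph-∪ G sub₁ sub₂)

    E₁∩E₂⊆E[V₁∩V₂] : E₁ ∩ E₂ ⊆ EdgesIn G ⊤ (V₁ ∩ V₂)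
    E₁∩E₂⊆E[V₁∩V₂] = IsSubgraph⇒⊆EdgesIn G (IsSubgraph-∩ G sub₁ sub₂)

    ∪-bound : ∣ E₁ ∪ E₂ ∣ + ℓ ≤ k * ∣ V₁ ∪ V₂ ∣
    ∪-bound = begin
      ∣ E₁ ∪ E₂ ∣ + ℓ                ≤⟨ ℕ.+-monoˡ-≤ ℓ (p⊆q⇒∣p∣≤∣q∣ E₁∪E₂⊆E[V₁∪V₂]) ⟩
      ∣ EdgesIn G ⊤ (V₁ ∪ V₂) ∣ + ℓ  ≤⟨ ∣EdgesIn∣+ℓ≤k*∣W∣ (V₁ ∪ V₂) ℓ≤k∣V₁∪V₂∣ ⟩
      k * ∣ V₁ ∪ V₂ ∣                ∎

    ∩-bound : ∣ EdgesIn G ⊤ (V₁ ∩ V₂) ∣ + ℓ ≤ k * ∣ V₁ ∩ V₂ ∣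
    ∩-bound = ∣EdgesIn∣+ℓ≤k*∣W∣ (V₁ ∩ V₂) ℓ≤k∣V₁∩V₂∣

    counting : k * ∣ V₁ ∪ V₂ ∣ + k * ∣ V₁ ∩ V₂ ∣ ≤ (∣ E₁ ∪ E₂ ∣ + ℓ) + (∣ EdgesIn G ⊤ (V₁ ∩ V₂) ∣ + ℓ)
    counting = begin
      k * ∣ V₁ ∪ V₂ ∣ + k * ∣ V₁ ∩ V₂ ∣      ≡⟨ ℕ.*-distribˡ-+ k (∣ V₁ ∪ V₂ ∣) (∣ V₁ ∩ V₂ ∣) ⟨
      k * (∣ V₁ ∪ V₂ ∣ + ∣ V₁ ∩ V₂ ∣)        ≡⟨ cong (k *_) (∣p∪q∣+∣p∩q∣≡∣p∣+∣q∣ V₁ V₂) ⟩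
      k * (∣ V₁ ∣ + ∣ V₂ ∣)                  ≡⟨ ℕ.*-distribˡ-+ k (∣ V₁ ∣) (∣ V₂ ∣) ⟩
      k * ∣ V₁ ∣ + k * ∣ V₂ ∣                ≡⟨ cong₂ _+_ count₁ count₂ ⟨
      (∣ E₁ ∣ + ℓ) + (∣ E₂ ∣ + ℓ)            ≡⟨ interchange (∣ E₁ ∣) ℓ (∣ E₂ ∣) ℓ ⟩
      (∣ E₁ ∣ + ∣ E₂ ∣) + (ℓ + ℓ)            ≡⟨ cong (_+ (ℓ + ℓ)) (∣p∪q∣+∣p∩q∣≡∣p∣+∣q∣ E₁ E₂) ⟨
      (∣ E₁ ∪ E₂ ∣ + ∣ E₁ ∩ E₂ ∣) + (ℓ + ℓ)  ≡⟨ interchange (∣ E₁ ∪ E₂ ∣) (∣ E₁ ∩ E₂ ∣) ℓ ℓ ⟩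
      (∣ E₁ ∪ E₂ ∣ + ℓ) + (∣ E₁ ∩ E₂ ∣ + ℓ)  ≤⟨ ℕ.+-monoʳ-≤ (∣ E₁ ∪ E₂ ∣ + ℓ) (ℕ.+-monoˡ-≤ ℓ (p⊆q⇒∣p∣≤∣q∣ E₁∩E₂⊆E[V₁∩V₂])) ⟩
      (∣ E₁ ∪ E₂ ∣ + ℓ) + (∣ EdgesIn G ⊤ (V₁ ∩ V₂) ∣ + ℓ) ∎

  IsBlock-∪-∩ : ∀ V₁ V₂ E₁ E₂ → ℓ ≤ k * ∣ V₁ ∩ V₂ ∣ →
                IsBlock G k ℓ V₁ E₁ → IsBlock G k ℓ V₂ E₂ →
                IsBlock G k ℓ (V₁ ∪ V₂) (E₁ ∪ E₂) × IsBlock G k ℓ (V₁ ∩ V₂) (EdgesIn G ⊤ (V₁ ∩ V₂))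
  IsBlock-∪-∩ V₁ V₂ E₁ E₂ ℓ≤k∣V₁∩V₂∣ B₁@(sub₁ , _) B₂@(sub₂ , _) =
    let ∪-count , ∩-count = ∪-∩-tight V₁ V₂ E₁ E₂ ℓ≤k∣V₁∩V₂∣ B₁ B₂
    in tight-subgraph⇒IsBlock (V₁ ∪ V₂) (E₁ ∪ E₂) (IsSubgraph-∪ G sub₁ sub₂) ∪-count ,
       tight-subgraph⇒IsBlock (V₁ ∩ V₂) (EdgesIn G ⊤ (V₁ ∩ V₂)) (EdgesIn-isSubgraph G ⊤ (V₁ ∩ V₂)) ∩-count

mainTheorem1 : ∀ (k i ℓ s : ℕ) {n m : ℕ} (G : Hypergraph n m) →
    1 ≤ k → ℓ ≤ i * k →
    SparseHypergraph G k ℓ → HasDimension G s → ℓ < s * k →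
    (V₁ V₂ : Subset n) (E₁ E₂ : Subset m) →
    IsBlock G k ℓ V₁ E₁ → IsBlock G k ℓ V₂ E₂ →
    i ≤ ∣ V₁ ∩ V₂ ∣ →
    IsBlock G k ℓ (V₁ ∪ V₂) (E₁ ∪ E₂)
      × IsBlock G k ℓ (V₁ ∩ V₂) (EdgesIn G ⊤ (V₁ ∩ V₂))
mainTheorem1 k i ℓ _ G _ ℓ≤i*k sparse _ _ V₁ V₂ E₁ E₂ B₁ B₂ i≤∣V₁∩V₂∣ =
  IsBlock-∪-∩ G k ℓ sparse V₁ V₂ E₁ E₂ ℓ≤k∣V₁∩V₂∣ B₁ B₂
  where
  open ℕ.≤-Reasoning

  ℓ≤k∣V₁∩V₂∣ : ℓ ≤ k * ∣ V₁ ∩ V₂ ∣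
  ℓ≤k∣V₁∩V₂∣ = begin
    ℓ                ≤⟨ ℓ≤i*k ⟩
    i * k            ≡⟨ ℕ.*-comm i k ⟩
    k * i            ≤⟨ ℕ.*-monoʳ-≤ k i≤∣V₁∩V₂∣ ⟩
    k * ∣ V₁ ∩ V₂ ∣  ∎
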